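{- Homeomorphism $\sim$ is a sound equivalence relation on weighted singly linked heaps over $P$: for all heaps $H,H'$ with $H\sim H'$, all pointer variables $x,y\in P$ and every transformer $\tau$, we have $\mathit{pathLength}(H,x,y)=\mathit{pathLength}(H',x,y)$, $\mathit{circular}(H,x)=\mathit{circular}(H',x)$, and $\tau(H)\sim\tau(H')$.
   Context: Fix a finite set $P$ of pointer variables containing a distinguished variable $\mathbf{null}$. A weighted heap over $P$ is $H=\langle L,G,w\rangle$ with $G$ a finite directed graph (vertices $V(G)$, edges $E(G)$), $w:E(G)\to\mathbb{N}_{>0}$, and $L:P\to V(G)$. $H$ is singly linked iff every vertex $v$ either has outdegree $1$ and $v\neq L(\mathbf{null})$, or has outdegree $0$ and $v=L(\mathbf{null})$; for $v\ne L(\mathbf{null})$, $\mathrm{succ}(v)$ is its unique successor. $\mathit{pathLength}(H,x,y)$ is the minimum total weight of a directed path from $L(x)$ to $L(y)$ ($0$ if $L(x)=L(y)$, $\infty$ if none). $\mathit{circular}(H,x)$ holds iff there is a non-empty directed path from $L(x)$ back to $L(x)$. Transformers (for pointer variables $x,y$): $\mathit{new}(H,x)$ adds a fresh vertex $q$, an edge $(q,L(\mathbf{null}))$ of weight $1$, and sets $L[x\mapsto q]$. $\mathit{assign}(H,x,y)$ sets $L[x\mapsto L(y)]$. $\mathit{lookup}(H,x,y)$: let $v=L(y)$; if the edge leaving $v$ has weight $1$, set $L[x\mapsto\mathrm{succ}(v)]$; otherwise first subdivide that edge into a first edge of weight $1$ to a fresh vertex $q$ followed by the remainder, and set $L[x\mapsto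 q]$. $\mathit{update}(H,x,y)$ replaces the edge leaving $L(x)$ by the edge $(L(x),L(y))$ of weight $1$. (Lookup and update are applied only where the required successor exists.) Subdividing an edge $(u,v)$: introduce a fresh vertex $q$ and replace $(u,v)$ by $(u,q),(q,v)$ with positive weights summing to $w(u,v)$; a subdivision of $H$ is obtained by finitely many (possibly zero) such steps. Reachable sub-heap $H|_P$: $H$ restricted to vertices reachable from some $L(p)$. $H,H'$ are isomorphic iff there is a weight-preserving graph isomorphism $f:H|_P\to H'|_P$ with $f(L(p))=L'(p)$ for all $p\in P$; $H\sim H'$ iff some subdivision of $H$ is isomorphic to some subdivision of $H'$. -}

module Defs where

open import Data.Nat using (ℕ; zero; suc; _+_; _≤_; _<_; _≤?_)
open import Data.Fin using (Fin; zero; suc; _≟_)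
open import Data.Product using (Σ; ∃; ∃-syntax; _×_; _,_)
open import Data.Sum using (_⊎_)
open import Data.Bool using (Bool; true; false; if_then_else_; _∧_)
open import Data.List using (List; length; filter; allFin)
open import Relation.Nullary using (¬_; does)
open import Relation.Binary.PropositionalEquality using (_≡_; _≢_)
open import Relation.Binary.Construct.Closure.ReflexiveTransitive using (Star)

-- Pointer variables: P = Fin m, with a distinguished element `null : Fin m`
-- (passed explicitly where needed).

-- The edge set and weight function
-- are encoded by W : Fin n → Fin n → ℕ :  (u,v) ∈ E(G) iff W u v > 0,
-- in which case w(u,v) = W u v (a positive natural number).

record Heap (m : ℕ) : Set where
  constructor heap
  field
    n : ℕ
    W : Fin n → Fin n → ℕ
    L : Fin m → Fin n
open Heap public

module _ {m : ℕ} where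

  outdeg : (H : Heap m) → Fin (n H) → ℕ
  outdeg H v = length (filter (λ u → 1 ≤? W H v u) (allFin (n H)))

  SinglyLinked : Fin m → Heap m → Set
  SinglyLinked null H = ∀ v →
      (outdeg H v ≡ 1 × v ≢ L H null) ⊎ (outdeg H v ≡ 0 × v ≡ L H null)

  data Path (H : Heap m) : Fin (n H) → Fin (n H) → ℕ → Set where
    [] : ∀ {u} → Path H u u 0
    _∷_ : ∀ {u v t d} → 0 < W H u v → Path H v t d → Path H u t (W H u v + d)

data ℕ∞ : Set where
  fin : ℕ → ℕ∞
  ∞   : ℕ∞

module _ {m : ℕ} where

  IsPathLength : (H : Heap m) → Fin m → Fin m → ℕ∞ → Set
  IsPathLength H x y (fin d) =
    Path H (L H x) (L H y) d × (∀ d' → Path H (L H x) (L H y) d' → d ≤ d')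
  IsPathLength H x y ∞ = ∀ d → ¬ Path H (L H x) (L H y) d

  Circular : Heap m → Fin m → Set
  Circular H x = ∃[ v ] ∃[ d ] (0 < W H (L H x) v × Path H v (L H x) d)

  Reachable : (H : Heap m) → Fin (n H) → Set
  Reachable H v = ∃[ p ] ∃[ d ] Path H (L H p) v d

  -- isomorphism of the reachable sub-heaps H|_P and H'|_P
  record Iso (H H' : Heap m) : Set where
    field
      f : Fin (n H) → Fin (n H')
      g : Fin (n H') → Fin (n H)
      f-reach : ∀ v → Reachable H v → Reachable H' (f v)
      g-reach : ∀ v → Reachable H' v → Reachable H (g v)
      g∘f : ∀ v → Reachable H v → g (f v) ≡ v
      f∘g : ∀ v → Reachable H' v → f (g v) ≡ v
      weight : ∀ u v → Reachable H u → Reachable H v → W H' (f u) (f v) ≡ W H u v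
      label : ∀ p → f (L H p) ≡ L H' p

  -- Subdividing edge (u,v) into (u,q),(q,v) with weights a,b; the fresh
  -- vertex q is `zero`, old vertex i becomes `suc i`.

  subdivide : (H : Heap m) → Fin (n H) → Fin (n H) → ℕ → ℕ → Heap m
  subdivide H u v a b = heap (suc (n H)) W' (λ p → suc (L H p))
    where
    W' : Fin (suc (n H)) → Fin (suc (n H)) → ℕ
    W' zero zero = 0
    W' zero (suc j) = if does (j ≟ v) then b else 0
    W' (suc i) zero = if does (i ≟ u) then a else 0
    W' (suc i) (suc j) = if does (i ≟ u) ∧ does (j ≟ v) then 0 else W H i j

  data SubdivStep : Heap m → Heap m → Set where
    subdiv : ∀ H u v a b → 0 < a → 0 < b → a + b ≡ W H u v →
             SubdivStep H (subdivide H u v a b)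

  Subdivision : Heap m → Heap m → Set
  Subdivision = Star SubdivStep

  _∼_ : Heap m → Heap m → Set
  H ∼ H' = ∃[ S ] ∃[ S' ] (Subdivision H S × Subdivision H' S' × Iso S S')

  setL : (H : Heap m) → Fin m → Fin (n H) → Heap m
  setL H x q = heap (n H) (W H) (λ p → if does (p ≟ x) then q else L H p)

  newHeap : Fin m → Heap m → Fin m → Heap m
  newHeap null H x = heap (suc (n H)) W' L'
    where
    W' : Fin (suc (n H)) → Fin (suc (n H)) → ℕ
    W' zero j = if does (j ≟ suc (L H null)) then 1 else 0
    W' (suc i) zero = 0
    W' (suc i) (suc j) = W H i j
    L' : Fin m → Fin (suc (n H))
    L' p = if does (p ≟ x) then zero else suc (L H p)

  updateHeap : Heap m → Fin m → Fin m → Heap m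
  updateHeap H x y = heap (n H) W' (L H)
    where
    W' : Fin (n H) → Fin (n H) → ℕ
    W' i j = if does (i ≟ L H x) then (if does (j ≟ L H y) then 1 else 0) else W H i j

data Transformer (m : ℕ) : Set where
  new    : Fin m → Transformer m
  assign : Fin m → Fin m → Transformer m
  lookup : Fin m → Fin m → Transformer m
  update : Fin m → Fin m → Transformer m

-- Step null τ H H₁ : "τ(H) = H₁" (lookup/update only where the required
-- successor exists).
data Step {m : ℕ} (null : Fin m) : Transformer m → Heap m → Heap m → Set where
  new     : ∀ {H x} → Step null (new x) H (newHeap null H x)
  assign  : ∀ {H x y} → Step null (assign x y) H (setL H x (L H y))
  lookup₁ : ∀ {H x y} s → W H (L H y) s ≡ 1 →
            Step null (lookup x y) H (setL H x s)
  lookup₂ : ∀ {H x y} s k → W H (L H y) s ≡ suc (suc k) →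
            Step null (lookup x y) H
              (setL (subdivide H (L H y) s 1 (suc k)) x zero)
  update  : ∀ {H x y} s → 0 < W H (L H x) s →
            Step null (update x y) H (updateHeap H x y)

module Submission where

-- The unit refinement  refine H  expands every edge (u,v) of weight w into a
-- chain of w unit steps through interior points  mid u v 0 … mid u v (w ∸ 2);
-- write  H ≈ H'  when the reachable parts of the refinements are isomorphic.
--   * A subdivision step does not change the refinement, so ∼ implies ≈.
--   * Every heap has a subdivision with all weights ≤ 1 (induction on the
--     excess Σ (w ∸ 1)), and for such heaps ≈ is heap isomorphism; so ≈
--     implies ∼.  Hence ∼ is ≈, an equivalence since isomorphisms compose.
-- Weighted paths are the unit walks between vertices of the refinement, so
-- path lengths and circularity are invariants of ≈.  Each transformer acts on
-- refinements compatibly with ≈; lookup uses singly-linkedness, which makes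
-- the unit successor of a vertex unique.

open import Defs
open import Data.Nat using (ℕ; zero; suc; _+_; _∸_; _≤_; _<_; z≤n; s≤s; z<s)
open import Data.Nat.Properties hiding (_≟_)
open import Data.Fin using (Fin; zero; suc; _≟_)
open import Data.Fin.Properties using (all?; ¬∀⟶∃¬; punchInᵢ≢i)
open import Data.Vec.Functional using (removeAt; replicate)
open import Algebra.Properties.CommutativeMonoid.Sum +-0-commutativeMonoid
  using (sum; sum-remove; sum-cong-≗; sum-replicate-zero)
open import Data.Product using (∃-syntax; _×_; _,_)
open import Data.Sum using (_⊎_; inj₁; inj₂)
open import Data.Bool using (true; false; if_then_else_)
open import Data.Empty using (⊥-elim)
open import Data.List using (List; []; _∷_; length)
open import Data.List.Membership.Propositional using (_∈_)
open import Data.List.Membership.Propositional.Properties using (∈-allFin; ∈-filter⁺)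
open import Data.List.Relation.Unary.Any using (here)
open import Relation.Nullary using (¬_; does; yes; no)
open import Relation.Nullary.Decidable using (dec-true; dec-false; _×-dec_)
open import Relation.Binary using (tri<; tri≈; tri>)
open import Relation.Binary.PropositionalEquality
open import Relation.Binary.Construct.Closure.ReflexiveTransitive using (ε; _◅_)
open import Function.Bundles using (_⇔_; mk⇔)

record PointedGraph (m : ℕ) : Set₁ where
  constructor pointed
  field
    Node : Set
    Edge : Node → Node → Set
    ℓ    : Fin m → Node
open PointedGraph public

data Walk {X : Set} (R : X → X → Set) : X → X → ℕ → Set where
  [] : ∀ {a} → Walk R a a 0
  _∷_ : ∀ {a b c d} → R a b → Walk R b c d → Walk R a c (suc d)

infixr 5 _∷_ _++ʷ_

_++ʷ_ : ∀ {X R} {a b c : X} {d e} → Walk R a b d → Walk R b c e → Walk R a c (d + e)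
[] ++ʷ q = q
(x ∷ p) ++ʷ q = x ∷ (p ++ʷ q)

_▷_ : ∀ {X R} {a b c : X} {d} → Walk R a b d → R b c → Walk R a c (suc d)
_▷_ {d = d} p e = subst (Walk _ _ _) (+-comm d 1) (p ++ʷ (e ∷ []))

module _ {m : ℕ} where
  Reach : (G : PointedGraph m) → Node G → Set
  Reach G a = ∃[ p ] ∃[ d ] Walk (Edge G) (ℓ G p) a d

  reach-ℓ : (G : PointedGraph m) → ∀ p → Reach G (ℓ G p)
  reach-ℓ G p = p , 0 , []

  reach-▷ : (G : PointedGraph m) → ∀ {a b} → Reach G a → Edge G a b → Reach G b
  reach-▷ G (p , d , q) e = p , suc d , (q ▷ e)

  reach-++ : (G : PointedGraph m) → ∀ {a b d} → Reach G a → Walk (Edge G) a b d → Reach G b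
  reach-++ G (p , d , q) r = p , _ , (q ++ʷ r)

  record _≅_ (G G' : PointedGraph m) : Set where
    field
      to        : Node G → Node G'
      from      : Node G' → Node G
      from∘to   : ∀ a → Reach G a → from (to a) ≡ a
      to∘from   : ∀ a → Reach G' a → to (from a) ≡ a
      to-edge   : ∀ a b → Reach G a → Edge G a b → Edge G' (to a) (to b)
      from-edge : ∀ a b → Reach G' a → Edge G' a b → Edge G (from a) (from b)
      to-ℓ      : ∀ p → to (ℓ G p) ≡ ℓ G' p
  open _≅_ public

  module _ {G G' : PointedGraph m} (I : G ≅ G') where
    walk-to : ∀ {a b d} → Reach G a → Walk (Edge G) a b d → Walk (Edge G') (to I a) (to I b) d
    walk-to ra [] = []
    walk-to ra (e ∷ q) = to-edge I _ _ ra e ∷ walk-to (reach-▷ G ra e) q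

    reach-to : ∀ {a} → Reach G a → Reach G' (to I a)
    reach-to (p , d , q) = p , d , subst (λ z → Walk (Edge G') z _ d) (to-ℓ I p) (walk-to (reach-ℓ G p) q)

    from-ℓ : ∀ p → from I (ℓ G' p) ≡ ℓ G p
    from-ℓ p = trans (cong (from I) (sym (to-ℓ I p))) (from∘to I _ (reach-ℓ G p))

  ≅-sym : {G G' : PointedGraph m} → G ≅ G' → G' ≅ G
  ≅-sym I = record
    { to = from I ; from = to I ; from∘to = to∘from I ; to∘from = from∘to I
    ; to-edge = from-edge I ; from-edge = to-edge I ; to-ℓ = from-ℓ I }

  reach-from : {G G' : PointedGraph m} (I : G ≅ G') → ∀ {a} → Reach G' a → Reach G (from I a)
  reach-from I = reach-to (≅-sym I)

  ≅-refl : (G : PointedGraph m) → G ≅ G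
  ≅-refl G = record
    { to = λ a → a ; from = λ a → a ; from∘to = λ _ _ → refl ; to∘from = λ _ _ → refl
    ; to-edge = λ _ _ _ e → e ; from-edge = λ _ _ _ e → e ; to-ℓ = λ _ → refl }

  ≅-trans : {G₁ G₂ G₃ : PointedGraph m} → G₁ ≅ G₂ → G₂ ≅ G₃ → G₁ ≅ G₃
  ≅-trans I J = record
    { to = λ a → to J (to I a)
    ; from = λ a → from I (from J a)
    ; from∘to = λ a r → trans (cong (from I) (from∘to J _ (reach-to I r))) (from∘to I a r)
    ; to∘from = λ a r → trans (cong (to J) (to∘from I _ (reach-from J r))) (to∘from J a r)
    ; to-edge = λ a b r e → to-edge J _ _ (reach-to I r) (to-edge I a b r e)
    ; from-edge = λ a b r e → from-edge I _ _ (reach-from J r) (from-edge J a b r e)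
    ; to-ℓ = λ p → trans (cong (to J) (to-ℓ I p)) (to-ℓ J p) }

  -- Redirecting the label x to a node c (the effect of x := … on graphs).
  relabel : (G : PointedGraph m) → Fin m → Node G → PointedGraph m
  relabel G x c = pointed (Node G) (Edge G) (λ p → if does (p ≟ x) then c else ℓ G p)

  relabel-reach : (G : PointedGraph m) (x : Fin m) (c : Node G) → Reach G c →
                  ∀ {a} → Reach (relabel G x c) a → Reach G a
  relabel-reach G x c rc (p , d , q) with does (p ≟ x)
  ... | true = reach-++ G rc q
  ... | false = reach-++ G (reach-ℓ G p) q

  relabel-≅ : {G G' : PointedGraph m} (I : G ≅ G') (x : Fin m) (c : Node G) (c' : Node G') →
              Reach G c → to I c ≡ c' → relabel G x c ≅ relabel G' x c'
  relabel-≅ {G} {G'} I x c c' rc tc = record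
    { to = to I ; from = from I
    ; from∘to = λ a r → from∘to I a (relabel-reach G x c rc r)
    ; to∘from = λ a r → to∘from I a (relabel-reach G' x c' rc' r)
    ; to-edge = λ a b r e → to-edge I a b (relabel-reach G x c rc r) e
    ; from-edge = λ a b r e → from-edge I a b (relabel-reach G' x c' rc' r) e
    ; to-ℓ = to-label }
    where
    rc' : Reach G' c'
    rc' = subst (Reach G') tc (reach-to I rc)
    to-label : ∀ p → to I (if does (p ≟ x) then c else ℓ G p) ≡ (if does (p ≟ x) then c' else ℓ G' p)
    to-label p with does (p ≟ x)
    ... | true = tc
    ... | false = to-ℓ I p

-- The unit refinement of a heap

-- Points of a refined heap with n vertices: a vertex, or the k-th interior
-- point of the edge (i , j).
data Point (N : ℕ) : Set where
  vtx : Fin N → Point N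
  mid : Fin N → Fin N → ℕ → Point N

-- Unit steps along an edge of weight  w i j : straight to  j  if the weight is
-- 1, otherwise through  mid i j 0 , … , mid i j (w i j ∸ 2).
data UnitStep {N : ℕ} (w : Fin N → Fin N → ℕ) : Point N → Point N → Set where
  vv : ∀ {i j} → w i j ≡ 1 → UnitStep w (vtx i) (vtx j)
  vm : ∀ {i j} → 1 < w i j → UnitStep w (vtx i) (mid i j 0)
  mm : ∀ {i j k} → suc (suc k) < w i j → UnitStep w (mid i j k) (mid i j (suc k))
  mv : ∀ {i j k} → suc (suc k) ≡ w i j → UnitStep w (mid i j k) (vtx j)

⌊_⌋ : ∀ {N} → Point N → Fin N
⌊ vtx v ⌋ = v
⌊ mid i j k ⌋ = i

mapPoint : ∀ {N N'} → (Fin N → Fin N') → Point N → Point N'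
mapPoint h (vtx v) = vtx (h v)
mapPoint h (mid i j k) = mid (h i) (h j) k

2+n≰1 : ∀ {k} → ¬ (suc (suc k) ≤ 1)
2+n≰1 (s≤s ())

≡1⇒0< : ∀ {w} → w ≡ 1 → 0 < w
≡1⇒0< refl = z<s

module _ {m : ℕ} where
  refine : Heap m → PointedGraph m
  refine H = pointed (Point (n H)) (UnitStep (W H)) (λ p → vtx (L H p))

  _≈_ : Heap m → Heap m → Set
  H ≈ H' = refine H ≅ refine H'

  module _ (H : Heap m) where
    private
      UWalk = Walk (UnitStep (W H))

    walk-from-mid : ∀ {u v} r k → suc (suc k) + r ≡ W H u v → UWalk (mid u v k) (vtx v) (suc r)
    walk-from-mid zero k eq = mv (trans (sym (+-identityʳ _)) eq) ∷ []
    walk-from-mid (suc r) k eq =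
      mm (subst (suc (suc k) <_) eq (m<m+n (suc (suc k)) z<s))
        ∷ walk-from-mid r (suc k) (trans (sym (+-suc (suc (suc k)) r)) eq)

    edge-walk : ∀ {u v} → 0 < W H u v → UWalk (vtx u) (vtx v) (W H u v)
    edge-walk {u} {v} _ with W H u v in eq
    ... | suc zero = vv eq ∷ []
    ... | suc (suc r) = vm (subst (1 <_) (sym eq) (s≤s (s≤s z≤n))) ∷ walk-from-mid r 0 (sym eq)

    toWalk : ∀ {u t d} → Path H u t d → UWalk (vtx u) (vtx t) d
    toWalk [] = []
    toWalk (p ∷ q) = edge-walk p ++ʷ toWalk q

    -- … and conversely (a walk from an interior point first finishes its edge)
    fromWalk : ∀ {u t d} → UWalk (vtx u) (vtx t) d → Path H u t d
    fromWalk-mid : ∀ {u v k t d} → UWalk (mid u v k) (vtx t) d →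
                   ∃[ d' ] (Path H v t d' × suc k + d ≡ W H u v + d')
    fromWalk [] = []
    fromWalk {d = suc d} (vv e ∷ q) =
      subst (Path H _ _) (cong (_+ d) e) (≡1⇒0< e ∷ fromWalk q)
    fromWalk {d = suc d} (vm e ∷ q) with fromWalk-mid q
    ... | d' , p , eq = subst (Path H _ _) (sym eq) (<-trans z<s e ∷ p)
    fromWalk-mid {k = k} {d = suc d} (mm e ∷ q) with fromWalk-mid q
    ... | d' , p , eq = d' , p , trans (+-suc (suc k) d) eq
    fromWalk-mid {k = k} {d = suc d} (mv e ∷ q) = d , fromWalk q , trans (+-suc (suc k) d) (cong (_+ d) e)

    path-snoc : ∀ {s i j d} → Path H s i d → 0 < W H i j → Path H s j (d + W H i j)
    path-snoc [] e = subst (Path H _ _) (+-identityʳ _) (e ∷ [])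
    path-snoc (p ∷ q) e = subst (Path H _ _) (sym (+-assoc (W H _ _) _ _)) (p ∷ path-snoc q e)

    reachable-step : ∀ {i j} → Reachable H i → 0 < W H i j → Reachable H j
    reachable-step (p , d , q) e = p , _ , path-snoc q e

    -- What reachability of a point says about H: its vertices are reachable
    -- in H and an interior point really lies inside its edge.
    Valid : Point (n H) → Set
    Valid (vtx v) = Reachable H v
    Valid (mid i j k) = Reachable H i × Reachable H j × suc k < W H i j

    valid-step : ∀ {a b} → Valid a → UnitStep (W H) a b → Valid b
    valid-step r (vv e) = reachable-step r (≡1⇒0< e)
    valid-step r (vm e) = r , reachable-step r (<-trans z<s e) , e
    valid-step (ri , rj , _) (mm e) = ri , rj , e
    valid-step (ri , rj , _) (mv e) = rj

    valid-walk : ∀ {a b d} → Valid a → UWalk a b d → Valid b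
    valid-walk r [] = r
    valid-walk r (e ∷ q) = valid-walk (valid-step r e) q

    reach-valid : ∀ {a} → Reach (refine H) a → Valid a
    reach-valid (p , d , q) = valid-walk (p , 0 , []) q

    reach-vtx : ∀ {v} → Reachable H v → Reach (refine H) (vtx v)
    reach-vtx (p , d , q) = p , d , toWalk q

module _ {m : ℕ} where
  Iso-sym : {H H' : Heap m} → Iso H H' → Iso H' H
  Iso-sym {H} {H'} I = record
    { f = Iso.g I ; g = Iso.f I ; f-reach = Iso.g-reach I ; g-reach = Iso.f-reach I
    ; g∘f = Iso.f∘g I ; f∘g = Iso.g∘f I
    ; weight = λ u v ru rv →
        trans (sym (Iso.weight I (Iso.g I u) (Iso.g I v) (Iso.g-reach I u ru) (Iso.g-reach I v rv)))
              (cong₂ (W H') (Iso.f∘g I u ru) (Iso.f∘g I v rv))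
    ; label = λ p → trans (cong (Iso.g I) (sym (Iso.label I p))) (Iso.g∘f I (L H p) (p , 0 , [])) }

  module _ {H H' : Heap m} (I : Iso H H') where
    private
      F = Iso.f I

    Iso-step : ∀ a b → Reach (refine H) a → UnitStep (W H) a b →
               UnitStep (W H') (mapPoint F a) (mapPoint F b)
    Iso-step (vtx i) (vtx j) r (vv e) =
      let ri = reach-valid H r ; rj = reachable-step H ri (≡1⇒0< e) in
      vv (trans (Iso.weight I i j ri rj) e)
    Iso-step (vtx i) (mid i j 0) r (vm e) =
      let ri = reach-valid H r ; rj = reachable-step H ri (<-trans z<s e) in
      vm (subst (1 <_) (sym (Iso.weight I i j ri rj)) e)
    Iso-step (mid i j k) _ r (mm e) with reach-valid H r
    ... | ri , rj , _ = mm (subst (suc (suc k) <_) (sym (Iso.weight I i j ri rj)) e)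
    Iso-step (mid i j k) _ r (mv e) with reach-valid H r
    ... | ri , rj , _ = mv (trans e (sym (Iso.weight I i j ri rj)))

    Iso-inverse : ∀ a → Reach (refine H) a → mapPoint (Iso.g I) (mapPoint F a) ≡ a
    Iso-inverse (vtx v) r = cong vtx (Iso.g∘f I v (reach-valid H r))
    Iso-inverse (mid i j k) r with reach-valid H r
    ... | ri , rj , _ = cong₂ (λ x y → mid x y k) (Iso.g∘f I i ri) (Iso.g∘f I j rj)

  Iso⇒≈ : {H H' : Heap m} → Iso H H' → H ≈ H'
  Iso⇒≈ I = record
    { to = mapPoint (Iso.f I) ; from = mapPoint (Iso.g I)
    ; from∘to = Iso-inverse I ; to∘from = Iso-inverse (Iso-sym I)
    ; to-edge = Iso-step I ; from-edge = Iso-step (Iso-sym I)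
    ; to-ℓ = λ p → cong vtx (Iso.label I p) }

  UnitWeights : Heap m → Set
  UnitWeights H = ∀ i j → W H i j ≤ 1

  unit-vtx : (K : Heap m) → UnitWeights K → ∀ {a} → Reach (refine K) a → vtx ⌊ a ⌋ ≡ a
  unit-vtx K U {vtx v} r = refl
  unit-vtx K U {mid i j k} r with reach-valid K r
  ... | _ , _ , lt = ⊥-elim (2+n≰1 (≤-trans lt (U i j)))

  vv-weight : ∀ {N} {w : Fin N → Fin N → ℕ} {i j} → UnitStep w (vtx i) (vtx j) → w i j ≡ 1
  vv-weight (vv e) = e

  ≤1-equal : ∀ {a b} → a ≤ 1 → b ≤ 1 → (a ≡ 1 → b ≡ 1) → (b ≡ 1 → a ≡ 1) → b ≡ a
  ≤1-equal z≤n z≤n _ _ = refl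
  ≤1-equal z≤n (s≤s z≤n) _ b⇒a = sym (b⇒a refl)
  ≤1-equal (s≤s z≤n) z≤n a⇒b _ = a⇒b refl
  ≤1-equal (s≤s z≤n) (s≤s z≤n) _ _ = refl

  ≈⇒Iso : {H H' : Heap m} → UnitWeights H → UnitWeights H' → H ≈ H' → Iso H H'
  ≈⇒Iso {H} {H'} UH UH' I = record
    { f = F ; g = G
    ; f-reach = λ v r → reach-valid H' (subst (Reach (refine H')) (sym (F-vtx r)) (reach-to I (reach-vtx H r)))
    ; g-reach = λ v r → reach-valid H (subst (Reach (refine H)) (sym (G-vtx r)) (reach-from I (reach-vtx H' r)))
    ; g∘f = λ v r → trans (cong (λ z → ⌊ from I z ⌋) (F-vtx r))
                          (cong ⌊_⌋ (from∘to I (vtx v) (reach-vtx H r)))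
    ; f∘g = λ v r → trans (cong (λ z → ⌊ to I z ⌋) (G-vtx r))
                          (cong ⌊_⌋ (to∘from I (vtx v) (reach-vtx H' r)))
    ; weight = λ u v ru rv → ≤1-equal (UH u v) (UH' (F u) (F v)) (forward ru rv) (backward ru rv)
    ; label = λ p → cong ⌊_⌋ (to-ℓ I p) }
    where
    -- both maps send reachable vertices to vertices (unit-vtx)
    F : Fin (n H) → Fin (n H')
    F v = ⌊ to I (vtx v) ⌋
    G : Fin (n H') → Fin (n H)
    G v = ⌊ from I (vtx v) ⌋
    F-vtx : ∀ {v} → Reachable H v → vtx (F v) ≡ to I (vtx v)
    F-vtx r = unit-vtx H' UH' (reach-to I (reach-vtx H r))
    G-vtx : ∀ {v} → Reachable H' v → vtx (G v) ≡ from I (vtx v)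
    G-vtx r = unit-vtx H UH (reach-from I (reach-vtx H' r))
    G-F : ∀ {v} → Reachable H v → from I (vtx (F v)) ≡ vtx v
    G-F r = trans (cong (from I) (F-vtx r)) (from∘to I _ (reach-vtx H r))
    forward : ∀ {u v} → Reachable H u → Reachable H v → W H u v ≡ 1 → W H' (F u) (F v) ≡ 1
    forward ru rv e =
      vv-weight (subst₂ (UnitStep (W H')) (sym (F-vtx ru)) (sym (F-vtx rv)) (to-edge I _ _ (reach-vtx H ru) (vv e)))
    backward : ∀ {u v} → Reachable H u → Reachable H v → W H' (F u) (F v) ≡ 1 → W H u v ≡ 1
    backward ru rv e = vv-weight (subst₂ (UnitStep (W H)) (G-F ru) (G-F rv) (from-edge I _ _ rFu (vv e)))
      where
      rFu : Reach (refine H') (vtx (F _))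
      rFu = subst (Reach (refine H')) (sym (F-vtx ru)) (reach-to I (reach-vtx H ru))

-- A subdivision step does not change the refinement

≡0-≮ : ∀ {w k} → w ≡ 0 → ¬ (k < w)
≡0-≮ refl ()

≡0-≢suc : ∀ {w k} → w ≡ 0 → ¬ (suc k ≡ w)
≡0-≢suc refl ()

-- The interior points
-- of (u,v) in H correspond to the interior points of (u,zero), the vertex
-- zero itself, and the interior points of (zero,v) in the subdivision S.
module SubdivisionStep {m : ℕ} (H : Heap m) (u v : Fin (n H)) (a' b' : ℕ)
                       (eq : suc a' + suc b' ≡ W H u v) where
  S : Heap m
  S = subdivide H u v (suc a') (suc b')

  W-old : ∀ i j → (i ≡ u × j ≡ v × W S (suc i) (suc j) ≡ 0)
                ⊎ (¬ (i ≡ u × j ≡ v) × W S (suc i) (suc j) ≡ W H i j)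
  W-old i j with i ≟ u | j ≟ v
  ... | yes refl | yes refl = inj₁ (refl , refl , refl)
  ... | yes refl | no j≢v = inj₂ ((λ (_ , e) → j≢v e) , refl)
  ... | no i≢u | _ = inj₂ ((λ (e , _) → i≢u e) , refl)

  W-into-new : ∀ i → (i ≡ u × W S (suc i) zero ≡ suc a') ⊎ (W S (suc i) zero ≡ 0)
  W-into-new i with i ≟ u
  ... | yes refl = inj₁ (refl , refl)
  ... | no _ = inj₂ refl

  W-out-of-new : ∀ j → (j ≡ v × W S zero (suc j) ≡ suc b') ⊎ (W S zero (suc j) ≡ 0)
  W-out-of-new j with j ≟ v
  ... | yes refl = inj₁ (refl , refl)
  ... | no _ = inj₂ refl

  W-u-new : W S (suc u) zero ≡ suc a'
  W-u-new = cong (if_then suc a' else 0) (dec-true (u ≟ u) refl)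

  W-new-v : W S zero (suc v) ≡ suc b'
  W-new-v = cong (if_then suc b' else 0) (dec-true (v ≟ v) refl)

  W≢1 : W H u v ≢ 1
  W≢1 e = 0≢1+n (trans (sym (suc-injective (trans eq e))) (+-suc a' b'))

  a<W : ∀ {x} → x ≤ suc a' → x < W H u v
  a<W {x} le = subst (x <_) eq (≤-<-trans le (m<m+n (suc a') z<s))

  a+x<W : ∀ {x} → x < suc b' → suc a' + x < W H u v
  a+x<W lt = subst (_ <_) eq (+-monoʳ-< (suc a') lt)

  a+2+t : ∀ t → suc a' + suc (suc t) ≡ suc (suc (suc a' + t))
  a+2+t t = trans (+-suc (suc a') (suc t)) (cong suc (+-suc (suc a') t))

  -- collapsing S back onto H; points on edges that do not exist in S are
  -- mapped arbitrarily since they are unreachable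
  collapse : Point (n S) → Point (n H)
  collapse (vtx zero) = mid u v a'
  collapse (vtx (suc i)) = vtx i
  collapse (mid zero j k) = mid u v (suc a' + k)
  collapse (mid (suc i) zero k) = mid u v k
  collapse (mid (suc i) (suc j) k) = mid i j k

  collapse-vv : ∀ {i j} → W S i j ≡ 1 → UnitStep (W H) (collapse (vtx i)) (collapse (vtx j))
  collapse-vv {zero} {zero} ()
  collapse-vv {zero} {suc j} e with W-out-of-new j
  ... | inj₁ (refl , e0) = mv (trans (sym (+-comm (suc a') 1)) (trans (cong (suc a' +_) (trans (sym e) e0)) eq))
  ... | inj₂ e0 = ⊥-elim (≡0-≢suc e0 (sym e))
  collapse-vv {suc i} {zero} e with W-into-new i
  ... | inj₁ (refl , e0) = subst (λ z → UnitStep (W H) (vtx u) (mid u v z))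
                             (sym (suc-injective (trans (sym e0) e))) (vm (a<W (s≤s z≤n)))
  ... | inj₂ e0 = ⊥-elim (≡0-≢suc e0 (sym e))
  collapse-vv {suc i} {suc j} e with W-old i j
  ... | inj₁ (_ , _ , e0) = ⊥-elim (≡0-≢suc e0 (sym e))
  ... | inj₂ (_ , e0) = vv (trans (sym e0) e)

  collapse-vm : ∀ {i j} → 1 < W S i j → UnitStep (W H) (collapse (vtx i)) (collapse (mid i j 0))
  collapse-vm {zero} {zero} ()
  collapse-vm {zero} {suc j} e with W-out-of-new j
  ... | inj₁ (refl , e0) = subst (λ z → UnitStep (W H) (mid u v a') (mid u v z)) (sym (+-identityʳ (suc a')))
                             (mm (subst (_< W H u v) (+-comm (suc a') 1) (a+x<W (subst (1 <_) e0 e))))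
  ... | inj₂ e0 = ⊥-elim (≡0-≮ e0 e)
  collapse-vm {suc i} {zero} e with W-into-new i
  ... | inj₁ (refl , e0) = vm (a<W (s≤s z≤n))
  ... | inj₂ e0 = ⊥-elim (≡0-≮ e0 e)
  collapse-vm {suc i} {suc j} e with W-old i j
  ... | inj₁ (_ , _ , e0) = ⊥-elim (≡0-≮ e0 e)
  ... | inj₂ (_ , e0) = vm (subst (1 <_) e0 e)

  collapse-mm : ∀ {i j k} → suc (suc k) < W S i j →
                UnitStep (W H) (collapse (mid i j k)) (collapse (mid i j (suc k)))
  collapse-mm {zero} {zero} ()
  collapse-mm {zero} {suc j} {k} e with W-out-of-new j
  ... | inj₁ (refl , e0) = subst (λ z → UnitStep (W H) (mid u v (suc a' + k)) (mid u v z))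
                             (sym (+-suc (suc a') k)) (mm (subst (_< W H u v) (a+2+t k) (a+x<W (subst (_ <_) e0 e))))
  ... | inj₂ e0 = ⊥-elim (≡0-≮ e0 e)
  collapse-mm {suc i} {zero} {k} e with W-into-new i
  ... | inj₁ (refl , e0) = mm (a<W (<⇒≤ (subst (_ <_) e0 e)))
  ... | inj₂ e0 = ⊥-elim (≡0-≮ e0 e)
  collapse-mm {suc i} {suc j} e with W-old i j
  ... | inj₁ (_ , _ , e0) = ⊥-elim (≡0-≮ e0 e)
  ... | inj₂ (_ , e0) = mm (subst (_ <_) e0 e)

  collapse-mv : ∀ {i j k} → suc (suc k) ≡ W S i j →
                UnitStep (W H) (collapse (mid i j k)) (collapse (vtx j))
  collapse-mv {zero} {zero} ()
  collapse-mv {zero} {suc j} {k} e with W-out-of-new j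
  ... | inj₁ (refl , e0) = mv (trans (sym (a+2+t k)) (trans (cong (suc a' +_) (trans e e0)) eq))
  ... | inj₂ e0 = ⊥-elim (≡0-≢suc e0 e)
  collapse-mv {suc i} {zero} {k} e with W-into-new i
  ... | inj₁ (refl , e0) = subst (λ z → UnitStep (W H) (mid u v k) (mid u v z)) (suc-injective (trans e e0))
                             (mm (a<W (≤-reflexive (trans e e0))))
  ... | inj₂ e0 = ⊥-elim (≡0-≢suc e0 e)
  collapse-mv {suc i} {suc j} e with W-old i j
  ... | inj₁ (_ , _ , e0) = ⊥-elim (≡0-≢suc e0 e)
  ... | inj₂ (_ , e0) = mv (trans e e0)

  collapse-step : ∀ {x y} → UnitStep (W S) x y → UnitStep (W H) (collapse x) (collapse y)
  collapse-step (vv e) = collapse-vv e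
  collapse-step (vm e) = collapse-vm e
  collapse-step (mm e) = collapse-mm e
  collapse-step (mv e) = collapse-mv e

  data Position (k : ℕ) : Set where
    before : suc k < suc a' → Position k
    at     : k ≡ a' → Position k
    after  : ∀ t → k ≡ suc a' + t → Position k

  position : ∀ k → Position k
  position k with <-cmp k a'
  ... | tri< lt _ _ = before (s≤s lt)
  ... | tri≈ _ e _ = at e
  ... | tri> _ _ gt = after (k ∸ suc a') (sym (m+[n∸m]≡n gt))

  point : ∀ {k} → Position k → Point (n S)
  point {k} (before _) = mid (suc u) zero k
  point (at _) = vtx zero
  point (after t _) = mid zero (suc v) t

  before-at : ∀ {k} → suc k < suc a' → k ≢ a'
  before-at lt refl = <-irrefl refl lt

  before-after : ∀ {k} t → suc k < suc a' → k ≢ suc a' + t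
  before-after t lt refl = m+n≮m (suc a') t (<⇒≤ lt)

  at-after : ∀ {k} t → k ≡ a' → k ≢ suc a' + t
  at-after t refl = m≢1+m+n a'

  point-unique : ∀ {k} (p q : Position k) → point p ≡ point q
  point-unique (before _) (before _) = refl
  point-unique (before lt) (at e) = ⊥-elim (before-at lt e)
  point-unique (before lt) (after t e) = ⊥-elim (before-after t lt e)
  point-unique (at e) (before lt) = ⊥-elim (before-at lt e)
  point-unique (at _) (at _) = refl
  point-unique (at e) (after t e') = ⊥-elim (at-after t e e')
  point-unique (after t e) (before lt) = ⊥-elim (before-after t lt e)
  point-unique (after t e') (at e) = ⊥-elim (at-after t e e')
  point-unique (after t refl) (after t' e') = cong (mid zero (suc v)) (+-cancelˡ-≡ (suc a') t t' e')

  expand : Point (n H) → Point (n S)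
  expand (vtx i) = vtx (suc i)
  expand (mid i j k) with (i ≟ u) ×-dec (j ≟ v)
  ... | yes _ = point (position k)
  ... | no _ = mid (suc i) (suc j) k

  expand-uv : ∀ k → expand (mid u v k) ≡ point (position k)
  expand-uv k with (u ≟ u) ×-dec (v ≟ v)
  ... | yes _ = refl
  ... | no ne = ⊥-elim (ne (refl , refl))

  expand-other : ∀ i j k → ¬ (i ≡ u × j ≡ v) → expand (mid i j k) ≡ mid (suc i) (suc j) k
  expand-other i j k ne with (i ≟ u) ×-dec (j ≟ v)
  ... | yes p = ⊥-elim (ne p)
  ... | no _ = refl

  collapse-point : ∀ {k} (p : Position k) → collapse (point p) ≡ mid u v k
  collapse-point (before _) = refl
  collapse-point (at e) = cong (mid u v) (sym e)
  collapse-point (after t e) = cong (mid u v) (sym e)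

  collapse-expand : ∀ a → collapse (expand a) ≡ a
  collapse-expand (vtx i) = refl
  collapse-expand (mid i j k) with W-old i j
  ... | inj₁ (refl , refl , _) = trans (cong collapse (expand-uv k)) (collapse-point (position k))
  ... | inj₂ (ne , _) = cong collapse (expand-other i j k ne)

  -- on reachable points of S (which lie inside existing edges) expand inverts collapse
  expand-collapse : ∀ a → Reach (refine S) a → expand (collapse a) ≡ a
  expand-collapse (vtx zero) r = trans (expand-uv a') (point-unique (position a') (at refl))
  expand-collapse (vtx (suc i)) r = refl
  expand-collapse (mid zero zero k) r with reach-valid S r
  ... | _ , _ , ()
  expand-collapse (mid zero (suc j) k) r with reach-valid S r | W-out-of-new j
  ... | _ , _ , lt | inj₁ (refl , e0) = trans (expand-uv (suc a' + k)) (point-unique (position _) (after k refl))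
  ... | _ , _ , lt | inj₂ e0 = ⊥-elim (≡0-≮ e0 lt)
  expand-collapse (mid (suc i) zero k) r with reach-valid S r | W-into-new i
  ... | _ , _ , lt | inj₁ (refl , e0) =
    trans (expand-uv k) (point-unique (position k) (before (subst (_ <_) e0 lt)))
  ... | _ , _ , lt | inj₂ e0 = ⊥-elim (≡0-≮ e0 lt)
  expand-collapse (mid (suc i) (suc j) k) r with reach-valid S r | W-old i j
  ... | _ , _ , lt | inj₁ (_ , _ , e0) = ⊥-elim (≡0-≮ e0 lt)
  ... | _ , _ , lt | inj₂ (ne , _) = expand-other i j k ne

  first-step : (p : Position 0) → UnitStep (W S) (vtx (suc u)) (point p)
  first-step (before lt) = vm (subst (1 <_) (sym W-u-new) lt)
  first-step (at e) = vv (trans W-u-new (cong suc (sym e)))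
  first-step (after t e) = ⊥-elim (0≢1+n e)

  inner-step : ∀ k → suc (suc k) < suc a' + suc b' → (p : Position k) →
               UnitStep (W S) (point p) (point (position (suc k)))
  inner-step k _ (before lt) with m≤n⇒m<n∨m≡n (≤-pred lt)
  ... | inj₁ lt' = subst (UnitStep (W S) _) (point-unique (before (s≤s lt')) (position (suc k)))
                         (mm (subst (suc (suc k) <_) (sym W-u-new) (s≤s lt')))
  ... | inj₂ e = subst (UnitStep (W S) _) (point-unique (at e) (position (suc k)))
                       (mv (trans (cong suc e) (sym W-u-new)))
  inner-step k big (at refl) =
    subst (UnitStep (W S) _) (point-unique (after 0 (sym (+-identityʳ (suc a')))) (position (suc k)))
      (vm (subst (1 <_) (sym W-new-v)
        (+-cancelˡ-< (suc a') 1 (suc b') (subst (_< suc a' + suc b') (sym (+-comm (suc a') 1)) big))))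
  inner-step k big (after t refl) =
    subst (UnitStep (W S) _) (point-unique (after (suc t) (sym (+-suc (suc a') t))) (position (suc k)))
      (mm (subst (suc (suc t) <_) (sym W-new-v)
        (+-cancelˡ-< (suc a') (suc (suc t)) (suc b') (subst (_< suc a' + suc b') (sym (a+2+t t)) big))))

  last-step : ∀ k → suc (suc k) ≡ suc a' + suc b' → (p : Position k) →
              UnitStep (W S) (point p) (vtx (suc v))
  last-step k e (before lt) =
    ⊥-elim (m+n≮m (suc a') b' (subst (_≤ suc a') (trans e (+-suc (suc a') b')) lt))
  last-step k e (at refl) =
    vv (trans W-new-v (sym (+-cancelˡ-≡ (suc a') 1 (suc b') (trans (+-comm (suc a') 1) e))))
  last-step k e (after t refl) =
    mv (trans (+-cancelˡ-≡ (suc a') (suc (suc t)) (suc b') (trans (a+2+t t) e)) (sym W-new-v))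

  expand-step : ∀ {x y} → UnitStep (W H) x y → UnitStep (W S) (expand x) (expand y)
  expand-step (vv {i} {j} e) with W-old i j
  ... | inj₁ (refl , refl , _) = ⊥-elim (W≢1 e)
  ... | inj₂ (_ , e0) = vv (trans e0 e)
  expand-step (vm {i} {j} e) with W-old i j
  ... | inj₁ (refl , refl , _) = subst (UnitStep (W S) _) (sym (expand-uv 0)) (first-step (position 0))
  ... | inj₂ (ne , e0) = subst (UnitStep (W S) _) (sym (expand-other i j 0 ne)) (vm (subst (1 <_) (sym e0) e))
  expand-step (mm {i} {j} {k} e) with W-old i j
  ... | inj₁ (refl , refl , _) = subst₂ (UnitStep (W S)) (sym (expand-uv k)) (sym (expand-uv (suc k)))
                                   (inner-step k (subst (_ <_) (sym eq) e) (position k))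
  ... | inj₂ (ne , e0) = subst₂ (UnitStep (W S)) (sym (expand-other i j k ne))
                           (sym (expand-other i j (suc k) ne)) (mm (subst (_ <_) (sym e0) e))
  expand-step (mv {i} {j} {k} e) with W-old i j
  ... | inj₁ (refl , refl , _) = subst (λ z → UnitStep (W S) z _) (sym (expand-uv k))
                                   (last-step k (trans e (sym eq)) (position k))
  ... | inj₂ (ne , e0) = subst (λ z → UnitStep (W S) z _) (sym (expand-other i j k ne))
                           (mv (trans e (sym e0)))

  subdivision-≈ : H ≈ S
  subdivision-≈ = record
    { to = expand ; from = collapse ; from∘to = λ a _ → collapse-expand a ; to∘from = expand-collapse
    ; to-edge = λ a b _ e → expand-step e ; from-edge = λ a b _ e → collapse-step e ; to-ℓ = λ p → refl }

-- Every heap has a unit-weight subdivision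

sum-single : ∀ {N} (f : Fin N → ℕ) v → (∀ j → j ≢ v → f j ≡ 0) → sum f ≡ f v
sum-single {suc N} f v off-v = begin
  sum f                         ≡⟨ sum-remove f ⟩
  f v + sum (removeAt f v)      ≡⟨ cong (f v +_) (sum-cong-≗ (λ j → off-v _ (punchInᵢ≢i v j))) ⟩
  f v + sum (replicate N 0)     ≡⟨ cong (f v +_) (sum-replicate-zero N) ⟩
  f v + 0                       ≡⟨ +-identityʳ (f v) ⟩
  f v                           ∎
  where open ≡-Reasoning

sum-update : ∀ {N} (f g : Fin N → ℕ) v → (∀ j → j ≢ v → f j ≡ g j) → sum f + g v ≡ sum g + f v
sum-update {suc N} f g v off-v = begin
  sum f + g v                   ≡⟨ cong (_+ g v) (sum-remove f) ⟩
  (f v + R) + g v               ≡⟨ +-comm (f v + R) (g v) ⟩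
  g v + (f v + R)               ≡⟨ cong (g v +_) (+-comm (f v) R) ⟩
  g v + (R + f v)               ≡⟨ sym (+-assoc (g v) R (f v)) ⟩
  (g v + R) + f v               ≡⟨ cong (λ z → (g v + z) + f v) (sum-cong-≗ same-rest) ⟩
  (g v + sum (removeAt g v)) + f v ≡⟨ sym (cong (_+ f v) (sum-remove g)) ⟩
  sum g + f v                   ∎
  where
  open ≡-Reasoning
  R = sum (removeAt f v)
  same-rest : ∀ j → removeAt f v j ≡ removeAt g v j
  same-rest j = off-v _ (punchInᵢ≢i v j)

module _ {m : ℕ} where
  excess : Heap m → ℕ
  excess H = sum (λ i → sum (λ j → W H i j ∸ 1))

  module ExcessDecrease (H : Heap m) (u v : Fin (n H)) (b' : ℕ) (eq : suc (suc b') ≡ W H u v) where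
    open SubdivisionStep H u v 0 b' eq

    row-H row-S : Fin (n H) → ℕ
    row-H i = sum (λ j → W H i j ∸ 1)
    row-S i = sum (λ j → W S (suc i) (suc j) ∸ 1)

    row-new : sum (λ j → W S zero j ∸ 1) ≡ b'
    row-new = trans (sum-single (λ j → W S zero (suc j) ∸ 1) v off-v) (cong (_∸ 1) W-new-v)
      where
      off-v : ∀ j → j ≢ v → W S zero (suc j) ∸ 1 ≡ 0
      off-v j ne with W-out-of-new j
      ... | inj₁ (e , _) = ⊥-elim (ne e)
      ... | inj₂ e = cong (_∸ 1) e

    -- the edge into the new vertex has weight ≤ 1 and adds no excess
    row-old : ∀ i → sum (λ j → W S (suc i) j ∸ 1) ≡ row-S i
    row-old i with W-into-new i
    ... | inj₁ (_ , e) = cong (λ w → (w ∸ 1) + row-S i) e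
    ... | inj₂ e = cong (λ w → (w ∸ 1) + row-S i) e

    row-unchanged : ∀ i → i ≢ u → row-S i ≡ row-H i
    row-unchanged i ne = sum-cong-≗ same
      where
      same : ∀ j → W S (suc i) (suc j) ∸ 1 ≡ W H i j ∸ 1
      same j with W-old i j
      ... | inj₁ (e , _) = ⊥-elim (ne e)
      ... | inj₂ (_ , e) = cong (_∸ 1) e

    row-u : row-S u + suc b' ≡ row-H u
    row-u = begin
      row-S u + suc b'                    ≡⟨ cong (row-S u +_) (cong (_∸ 1) eq) ⟩
      row-S u + (W H u v ∸ 1)             ≡⟨ sum-update _ (λ j → W H u j ∸ 1) v same ⟩
      row-H u + (W S (suc u) (suc v) ∸ 1) ≡⟨ cong (λ w → row-H u + (w ∸ 1)) removed ⟩
      row-H u + 0                         ≡⟨ +-identityʳ _ ⟩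
      row-H u                             ∎
      where
      open ≡-Reasoning
      removed : W S (suc u) (suc v) ≡ 0
      removed with W-old u v
      ... | inj₁ (_ , _ , e) = e
      ... | inj₂ (ne , _) = ⊥-elim (ne (refl , refl))
      same : ∀ j → j ≢ v → W S (suc u) (suc j) ∸ 1 ≡ W H u j ∸ 1
      same j ne with W-old u j
      ... | inj₁ (_ , e , _) = ⊥-elim (ne e)
      ... | inj₂ (_ , e) = cong (_∸ 1) e

    rows-total : suc b' + sum row-S ≡ sum row-H
    rows-total = +-cancelʳ-≡ (row-S u) _ _ (begin
      (suc b' + sum row-S) + row-S u   ≡⟨ cong (_+ row-S u) (+-comm (suc b') _) ⟩
      (sum row-S + suc b') + row-S u   ≡⟨ +-assoc (sum row-S) (suc b') (row-S u) ⟩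
      sum row-S + (suc b' + row-S u)   ≡⟨ cong (sum row-S +_) (trans (+-comm (suc b') (row-S u)) row-u) ⟩
      sum row-S + row-H u              ≡⟨ sum-update row-S row-H u row-unchanged ⟩
      sum row-H + row-S u              ∎)
      where open ≡-Reasoning

    decrease : excess S < excess H
    decrease = subst₂ _<_ (sym excess-S) rows-total (+-monoˡ-< (sum row-S) (n<1+n b'))
      where
      excess-S : excess S ≡ b' + sum row-S
      excess-S = cong₂ _+_ row-new (sum-cong-≗ row-old)

  unit-weights? : (H : Heap m) → UnitWeights H ⊎ ∃[ i ] ∃[ j ] ∃[ b' ] (suc (suc b') ≡ W H i j)
  unit-weights? H with all? (λ i → all? (λ j → W H i j ≤? 1))
  ... | yes unit = inj₁ unit
  ... | no ¬unit with ¬∀⟶∃¬ _ _ (λ i → all? (λ j → W H i j ≤? 1)) ¬unit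
  ...   | i , ¬row with ¬∀⟶∃¬ _ _ (λ j → W H i j ≤? 1) ¬row
  ...     | j , ¬w≤1 with W H i j in e
  ...       | zero = ⊥-elim (¬w≤1 z≤n)
  ...       | suc zero = ⊥-elim (¬w≤1 (s≤s z≤n))
  ...       | suc (suc b') = inj₂ (i , j , b' , sym e)

  -- Repeatedly split off unit steps of edges of weight ≥ 2 (well-founded on
  -- the excess) until all weights are at most 1.
  unit-subdivision-below : ∀ k (H : Heap m) → excess H < k → ∃[ U ] (Subdivision H U × UnitWeights U)
  unit-subdivision-below (suc k) H lt with unit-weights? H
  ... | inj₁ unit = H , ε , unit
  ... | inj₂ (i , j , b' , e)
    with unit-subdivision-below k (SubdivisionStep.S H i j 0 b' e)
                                  (≤-trans (ExcessDecrease.decrease H i j b' e) (≤-pred lt))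
  ...   | U , steps , unit = U , subdiv H i j 1 (suc b') z<s z<s e ◅ steps , unit

  unit-subdivision : (H : Heap m) → ∃[ U ] (Subdivision H U × UnitWeights U)
  unit-subdivision H = unit-subdivision-below (suc (excess H)) H ≤-refl

  step-≈ : {H S : Heap m} → SubdivStep H S → H ≈ S
  step-≈ (subdiv H u v (suc a') (suc b') (s≤s z≤n) (s≤s z≤n) e) =
    SubdivisionStep.subdivision-≈ H u v a' b' e

  subdivision⇒≈ : {H S : Heap m} → Subdivision H S → H ≈ S
  subdivision⇒≈ ε = ≅-refl _
  subdivision⇒≈ (s ◅ ss) = ≅-trans (step-≈ s) (subdivision⇒≈ ss)

  ∼⇒≈ : {H H' : Heap m} → H ∼ H' → H ≈ H'
  ∼⇒≈ (S , S' , H→S , H'→S' , I) =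
    ≅-trans (subdivision⇒≈ H→S) (≅-trans (Iso⇒≈ I) (≅-sym (subdivision⇒≈ H'→S')))

  ≈⇒∼ : {H H' : Heap m} → H ≈ H' → H ∼ H'
  ≈⇒∼ {H} {H'} I with unit-subdivision H | unit-subdivision H'
  ... | U , H→U , unit | U' , H'→U' , unit' =
    U , U' , H→U , H'→U' ,
    ≈⇒Iso unit unit' (≅-trans (≅-sym (subdivision⇒≈ H→U)) (≅-trans I (subdivision⇒≈ H'→U')))

-- Path lengths and circularity are invariants of ≈

module _ {m : ℕ} where
  -- weighted paths between labelled vertices are unit walks, which isomorphisms move
  path-≈ : {H H' : Heap m} → H ≈ H' → ∀ x y {d} → Path H (L H x) (L H y) d → Path H' (L H' x) (L H' y) d
  path-≈ {H} {H'} I x y q =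
    fromWalk H' (subst₂ (λ a b → Walk (UnitStep (W H')) a b _) (to-ℓ I x) (to-ℓ I y)
                        (walk-to I (reach-ℓ (refine H) x) (toWalk H q)))

  pathLength-≈ : {H H' : Heap m} → H ≈ H' → ∀ x y r → IsPathLength H x y r → IsPathLength H' x y r
  pathLength-≈ I x y (fin d) (q , minimal) = path-≈ I x y q , λ d' q' → minimal d' (path-≈ (≅-sym I) x y q')
  pathLength-≈ I x y ∞ none = λ d q' → none d (path-≈ (≅-sym I) x y q')

  circular⇒cycle : (H : Heap m) → ∀ x → Circular H x → ∃[ d ] (0 < d × Path H (L H x) (L H x) d)
  circular⇒cycle H x (v , d , p , q) = _ , ≤-trans p (m≤m+n _ d) , p ∷ q

  cycle⇒circular : (H : Heap m) → ∀ x {d} → 0 < d → Path H (L H x) (L H x) d → Circular H x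
  cycle⇒circular H x _ (_∷_ {v = v} p q) = v , _ , p , q

  circular-≈ : {H H' : Heap m} → H ≈ H' → ∀ x → Circular H x → Circular H' x
  circular-≈ {H} {H'} I x c with circular⇒cycle H x c
  ... | d , pos , q = cycle⇒circular H' x pos (path-≈ I x x q)

module _ {m : ℕ} where
  setL-≅ : (H : Heap m) (x : Fin m) (q : Fin (n H)) → refine (setL H x q) ≅ relabel (refine H) x (vtx q)
  setL-≅ H x q = record
    { to = λ a → a ; from = λ a → a ; from∘to = λ _ _ → refl ; to∘from = λ _ _ → refl
    ; to-edge = λ _ _ _ e → e ; from-edge = λ _ _ _ e → e ; to-ℓ = same-label }
    where
    same-label : ∀ p → vtx (if does (p ≟ x) then q else L H p) ≡ (if does (p ≟ x) then vtx q else vtx (L H p))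
    same-label p with does (p ≟ x)
    ... | true = refl
    ... | false = refl

  assign-≈ : ∀ {x y} {H H' : Heap m} → H ≈ H' → setL H x (L H y) ≈ setL H' x (L H' y)
  assign-≈ {x} {y} {H} {H'} I =
    ≅-trans (setL-≅ H x (L H y))
            (≅-trans (relabel-≅ I x _ _ (reach-ℓ (refine H) y) (to-ℓ I y)) (≅-sym (setL-≅ H' x (L H' y))))

≤1-member-unique : ∀ {A : Set} {xs : List A} {a b : A} → length xs ≤ 1 → a ∈ xs → b ∈ xs → a ≡ b
≤1-member-unique {xs = _ ∷ []} _ (here refl) (here refl) = refl
≤1-member-unique {xs = _ ∷ _ ∷ _} (s≤s ()) _ _

module _ {m : ℕ} (null : Fin m) where
  successor-unique : (H : Heap m) → SinglyLinked null H → ∀ {v a b} → 0 < W H v a → 0 < W H v b → a ≡ b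
  successor-unique H linked {v} {a} {b} pa pb =
    ≤1-member-unique outdeg≤1 (∈-filter⁺ (λ u → 1 ≤? W H v u) (∈-allFin a) pa)
                              (∈-filter⁺ (λ u → 1 ≤? W H v u) (∈-allFin b) pb)
    where
    outdeg≤1 : outdeg H v ≤ 1
    outdeg≤1 with linked v
    ... | inj₁ (o , _) = ≤-reflexive o
    ... | inj₂ (o , _) = subst (_≤ 1) (sym o) z≤n

  unit-successor-unique : (H : Heap m) → SinglyLinked null H →
                          ∀ {v c c'} → UnitStep (W H) (vtx v) c → UnitStep (W H) (vtx v) c' → c ≡ c'
  unit-successor-unique H linked (vv e) (vv e') with successor-unique H linked (≡1⇒0< e) (≡1⇒0< e')
  ... | refl = refl
  unit-successor-unique H linked (vv e) (vm e') with successor-unique H linked (≡1⇒0< e) (<-trans z<s e')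
  ... | refl = ⊥-elim (<-irrefl (sym e) e')
  unit-successor-unique H linked (vm e) (vv e') with successor-unique H linked (<-trans z<s e) (≡1⇒0< e')
  ... | refl = ⊥-elim (<-irrefl (sym e') e)
  unit-successor-unique H linked (vm e) (vm e') with successor-unique H linked (<-trans z<s e) (<-trans z<s e')
  ... | refl = refl

  -- lookup moves x to the unit successor of y (subdividing the edge if needed)
  lookup-relabels : ∀ {x y} (H : Heap m) {H₁ : Heap m} → Step null (lookup x y) H H₁ →
                    ∃[ c ] (UnitStep (W H) (vtx (L H y)) c × refine H₁ ≅ relabel (refine H) x c)
  lookup-relabels {x} {y} H (lookup₁ s e) = vtx s , vv e , setL-≅ H x s
  lookup-relabels {x} {y} H (lookup₂ s k e) =
    mid (L H y) s 0 , vm (subst (1 <_) (sym e) (s≤s (s≤s z≤n))) ,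
    ≅-trans (setL-≅ S x zero)
            (relabel-≅ (≅-sym (subdivision-≈ )) x (vtx zero) (mid (L H y) s 0) reach-new refl)
    where
    open SubdivisionStep H (L H y) s 0 k (sym e)
    reach-new : Reach (refine S) (vtx zero)
    reach-new = y , 1 , vv W-u-new ∷ []

  lookup-≈ : ∀ {x y} {H H' H₁ H₁' : Heap m} → SinglyLinked null H' → H ≈ H' →
             Step null (lookup x y) H H₁ → Step null (lookup x y) H' H₁' → H₁ ≈ H₁'
  lookup-≈ {x} {y} {H} {H'} linked' I st st' with lookup-relabels H st | lookup-relabels H' st'
  ... | c , e , J | c' , e' , J' =
    ≅-trans J (≅-trans (relabel-≅ I x c c' (reach-▷ (refine H) ry e) to-c≡c') (≅-sym J'))
    where
    ry : Reach (refine H) (vtx (L H y))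
    ry = reach-ℓ (refine H) y
    to-c≡c' : to I c ≡ c'
    to-c≡c' = unit-successor-unique H' linked'
                (subst (λ z → UnitStep (W H') z (to I c)) (to-ℓ I y) (to-edge I _ _ ry e)) e'

module Update {m : ℕ} (x y : Fin m) where
  module _ (H : Heap m) where
    U : Heap m
    U = updateHeap H x y

    W-other : ∀ {i j} → i ≢ L H x → W U i j ≡ W H i j
    W-other {i} {j} ne = cong (if_then _ else W H i j) (dec-false (i ≟ L H x) ne)

    W-from-x : ∀ j → (j ≡ L H y × W U (L H x) j ≡ 1) ⊎ W U (L H x) j ≡ 0
    W-from-x j rewrite dec-true (L H x ≟ L H x) refl with j ≟ L H y
    ... | yes e = inj₁ (e , refl)
    ... | no _ = inj₂ refl

    W-from-x≤1 : ∀ j → W U (L H x) j ≤ 1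
    W-from-x≤1 j with W-from-x j
    ... | inj₁ (_ , e) = ≤-reflexive e
    ... | inj₂ e = subst (_≤ 1) (sym e) z≤n

    W-x-y : W U (L H x) (L H y) ≡ 1
    W-x-y rewrite dec-true (L H x ≟ L H x) refl | dec-true (L H y ≟ L H y) refl = refl

    step-U⇒H : ∀ {a b} → UnitStep (W U) a b →
               (a ≡ vtx (L H x) × b ≡ vtx (L H y)) ⊎ (⌊ a ⌋ ≢ L H x × UnitStep (W H) a b)
    step-U⇒H {a} e with ⌊ a ⌋ ≟ L H x
    step-U⇒H (vv {j = j} e) | yes refl with W-from-x j
    ... | inj₁ (refl , _) = inj₁ (refl , refl)
    ... | inj₂ e0 = ⊥-elim (≡0-≢suc e0 (sym e))
    step-U⇒H (vm {j = j} e) | yes refl = ⊥-elim (1+n≰n (≤-trans e (W-from-x≤1 j)))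
    step-U⇒H (mm {j = j} e) | yes refl = ⊥-elim (2+n≰1 (≤-trans (<⇒≤ e) (W-from-x≤1 j)))
    step-U⇒H (mv {j = j} e) | yes refl = ⊥-elim (2+n≰1 (subst (_≤ 1) (sym e) (W-from-x≤1 j)))
    step-U⇒H (vv e) | no ne = inj₂ (ne , vv (trans (sym (W-other ne)) e))
    step-U⇒H (vm e) | no ne = inj₂ (ne , vm (subst (1 <_) (W-other ne) e))
    step-U⇒H (mm e) | no ne = inj₂ (ne , mm (subst (_ <_) (W-other ne) e))
    step-U⇒H (mv e) | no ne = inj₂ (ne , mv (trans e (W-other ne)))

    step-H⇒U : ∀ {a b} → ⌊ a ⌋ ≢ L H x → UnitStep (W H) a b → UnitStep (W U) a b
    step-H⇒U ne (vv e) = vv (trans (W-other ne) e)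
    step-H⇒U ne (vm e) = vm (subst (1 <_) (sym (W-other ne)) e)
    step-H⇒U ne (mm e) = mm (subst (_ <_) (sym (W-other ne)) e)
    step-H⇒U ne (mv e) = mv (trans e (sym (W-other ne)))

    walk-U⇒reach-H : ∀ {a b d} → Reach (refine H) a → Walk (UnitStep (W U)) a b d → Reach (refine H) b
    walk-U⇒reach-H r [] = r
    walk-U⇒reach-H r (e ∷ q) with step-U⇒H e
    ... | inj₁ (_ , refl) = walk-U⇒reach-H (reach-ℓ (refine H) y) q
    ... | inj₂ (_ , e') = walk-U⇒reach-H (reach-▷ (refine H) r e') q

    reach-U⇒H : ∀ {a} → Reach (refine U) a → Reach (refine H) a
    reach-U⇒H (p , d , q) = walk-U⇒reach-H (reach-ℓ (refine H) p) q

    -- the edge out of x has weight ≤ 1, so no interior point lies on it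
    on-x⇒vertex : ∀ {a} → Reach (refine U) a → ⌊ a ⌋ ≡ L H x → a ≡ vtx (L H x)
    on-x⇒vertex {vtx v} r refl = refl
    on-x⇒vertex {mid i j k} r refl with reach-valid U r
    ... | _ , _ , lt = ⊥-elim (2+n≰1 (≤-trans lt (W-from-x≤1 j)))

  module _ {H H' : Heap m} (I : H ≈ H') where
    step-to : ∀ {a b} → Reach (refine (U H)) a → Reach (refine (U H')) (to I a) →
              UnitStep (W (U H)) a b → UnitStep (W (U H')) (to I a) (to I b)
    step-to {a} {b} ra rta e with step-U⇒H H e
    ... | inj₁ (refl , refl) = subst₂ (UnitStep (W (U H'))) (sym (to-ℓ I x)) (sym (to-ℓ I y)) (vv (W-x-y H'))
    ... | inj₂ (ne , e') = step-H⇒U H' ne' (to-edge I a b (reach-U⇒H H ra) e')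
      where
      ne' : ⌊ to I a ⌋ ≢ L H' x
      ne' on-x = ne (cong ⌊_⌋ (begin
        a                       ≡⟨ sym (from∘to I a (reach-U⇒H H ra)) ⟩
        from I (to I a)         ≡⟨ cong (from I) (on-x⇒vertex H' rta on-x) ⟩
        from I (vtx (L H' x))   ≡⟨ from-ℓ I x ⟩
        vtx (L H x)             ∎))
        where open ≡-Reasoning

    walk-to-U : ∀ {a b d} → Reach (refine (U H)) a → Reach (refine (U H')) (to I a) →
                Walk (UnitStep (W (U H))) a b d → Reach (refine (U H')) (to I b)
    walk-to-U ra rta [] = rta
    walk-to-U ra rta (e ∷ q) =
      walk-to-U (reach-▷ (refine (U H)) ra e) (reach-▷ (refine (U H')) rta (step-to ra rta e)) q

    reach-to-U : ∀ {a} → Reach (refine (U H)) a → Reach (refine (U H')) (to I a)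
    reach-to-U (p , d , q) =
      walk-to-U (reach-ℓ (refine (U H)) p)
                (subst (Reach (refine (U H'))) (sym (to-ℓ I p)) (reach-ℓ (refine (U H')) p)) q

  -- the same vertex map is an isomorphism of the updated refinements
  update-≈ : {H H' : Heap m} → H ≈ H' → U H ≈ U H'
  update-≈ {H} {H'} I = record
    { to = to I ; from = from I
    ; from∘to = λ a r → from∘to I a (reach-U⇒H H r)
    ; to∘from = λ a r → to∘from I a (reach-U⇒H H' r)
    ; to-edge = λ a b r e → step-to I r (reach-to-U I r) e
    ; from-edge = λ a b r e → step-to (≅-sym I) r (reach-to-U (≅-sym I) r) e
    ; to-ℓ = to-ℓ I }

-- Extend a point map to heaps with an extra vertex  zero  (fixed by the map);
-- points on edges touching  zero  other than  vtx zero  are never reachable.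
extend : ∀ {N N'} → (Point N → Point N') → Point (suc N) → Point (suc N')
extend h (vtx zero) = vtx zero
extend h (vtx (suc i)) = mapPoint suc (h (vtx i))
extend h (mid zero j k) = mid zero zero k
extend h (mid (suc i) zero k) = mid zero zero k
extend h (mid (suc i) (suc j) k) = mapPoint suc (h (mid i j k))

extend-shift : ∀ {N N'} (h : Point N → Point N') b → extend h (mapPoint suc b) ≡ mapPoint suc (h b)
extend-shift h (vtx i) = refl
extend-shift h (mid i j k) = refl

module New {m : ℕ} (null x : Fin m) where
  module _ (H : Heap m) where
    N : Heap m
    N = newHeap null H x

    W-fresh : ∀ j → (j ≡ suc (L H null) × W N zero j ≡ 1) ⊎ W N zero j ≡ 0
    W-fresh j with j ≟ suc (L H null)
    ... | yes e = inj₁ (e , refl)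
    ... | no _ = inj₂ refl

    W-fresh-null : W N zero (suc (L H null)) ≡ 1
    W-fresh-null = cong (if_then 1 else 0) (dec-true (suc (L H null) ≟ suc (L H null)) refl)

    step-fresh : ∀ {c} → UnitStep (W N) (vtx zero) c → c ≡ vtx (suc (L H null))
    step-fresh (vv {j = j} e) with W-fresh j
    ... | inj₁ (refl , _) = refl
    ... | inj₂ e0 = ⊥-elim (≡0-≢suc e0 (sym e))
    step-fresh (vm {j = j} e) with W-fresh j
    ... | inj₁ (_ , e0) = ⊥-elim (<-irrefl (sym e0) e)
    ... | inj₂ e0 = ⊥-elim (≡0-≮ e0 e)

    step-old⇒H : ∀ {b c} → UnitStep (W N) (mapPoint suc b) c →
                 ∃[ c' ] (c ≡ mapPoint suc c' × UnitStep (W H) b c')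
    step-old⇒H {vtx i} (vv {j = zero} ())
    step-old⇒H {vtx i} (vv {j = suc j} e) = vtx j , refl , vv e
    step-old⇒H {vtx i} (vm {j = zero} ())
    step-old⇒H {vtx i} (vm {j = suc j} e) = mid i j 0 , refl , vm e
    step-old⇒H {mid i j k} (mm e) = mid i j (suc k) , refl , mm e
    step-old⇒H {mid i j k} (mv e) = vtx j , refl , mv e

    step-H⇒old : ∀ {b c} → UnitStep (W H) b c → UnitStep (W N) (mapPoint suc b) (mapPoint suc c)
    step-H⇒old (vv e) = vv e
    step-H⇒old (vm e) = vm e
    step-H⇒old (mm e) = mm e
    step-H⇒old (mv e) = mv e

    Reach-N : Point (n N) → Set
    Reach-N a = a ≡ vtx zero ⊎ ∃[ b ] (a ≡ mapPoint suc b × Reach (refine H) b)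

    reach-N-step : ∀ {a c} → Reach-N a → UnitStep (W N) a c → Reach-N c
    reach-N-step (inj₁ refl) e = inj₂ (vtx (L H null) , step-fresh e , reach-ℓ (refine H) null)
    reach-N-step (inj₂ (b , refl , rb)) e with step-old⇒H e
    ... | c' , refl , e' = inj₂ (c' , refl , reach-▷ (refine H) rb e')

    reach-N-walk : ∀ {a c d} → Reach-N a → Walk (UnitStep (W N)) a c d → Reach-N c
    reach-N-walk ra [] = ra
    reach-N-walk ra (e ∷ q) = reach-N-walk (reach-N-step ra e) q

    reach-N-ℓ : ∀ p → Reach-N (vtx (L N p))
    reach-N-ℓ p with does (p ≟ x)
    ... | true = inj₁ refl
    ... | false = inj₂ (vtx (L H p) , refl , reach-ℓ (refine H) p)

    reach-N : ∀ {a} → Reach (refine N) a → Reach-N a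
    reach-N (p , d , q) = reach-N-walk (reach-N-ℓ p) q

  module _ {H H' : Heap m} (I : H ≈ H') where
    extend-inverse : ∀ a → Reach (refine (N H)) a → extend (from I) (extend (to I) a) ≡ a
    extend-inverse a r with reach-N H r
    ... | inj₁ refl = refl
    ... | inj₂ (b , refl , rb) = begin
      extend (from I) (extend (to I) (mapPoint suc b)) ≡⟨ cong (extend (from I)) (extend-shift (to I) b) ⟩
      extend (from I) (mapPoint suc (to I b))          ≡⟨ extend-shift (from I) (to I b) ⟩
      mapPoint suc (from I (to I b))                   ≡⟨ cong (mapPoint suc) (from∘to I b rb) ⟩
      mapPoint suc b                                   ∎
      where open ≡-Reasoning

    extend-step : ∀ a c → Reach (refine (N H)) a → UnitStep (W (N H)) a c →
                  UnitStep (W (N H')) (extend (to I) a) (extend (to I) c)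
    extend-step a c r e with reach-N H r
    ... | inj₁ refl rewrite step-fresh H e =
      subst (λ z → UnitStep (W (N H')) (vtx zero) (mapPoint suc z)) (sym (to-ℓ I null)) (vv (W-fresh-null H'))
    ... | inj₂ (b , refl , rb) with step-old⇒H H e
    ...   | c' , refl , e' = subst₂ (UnitStep (W (N H'))) (sym (extend-shift (to I) b)) (sym (extend-shift (to I) c'))
                               (step-H⇒old H' (to-edge I b c' rb e'))

    extend-ℓ : ∀ p → extend (to I) (vtx (L (N H) p)) ≡ vtx (L (N H') p)
    extend-ℓ p with does (p ≟ x)
    ... | true = refl
    ... | false = cong (mapPoint suc) (to-ℓ I p)

  new-≈ : {H H' : Heap m} → H ≈ H' → N H ≈ N H'
  new-≈ I = record
    { to = extend (to I) ; from = extend (from I)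
    ; from∘to = extend-inverse I ; to∘from = extend-inverse (≅-sym I)
    ; to-edge = extend-step I ; from-edge = extend-step (≅-sym I) ; to-ℓ = extend-ℓ I }

theorem2 : ∀ {m : ℕ} (null : Fin m) →
    ((H : Heap m) → SinglyLinked null H → H ∼ H)
  × ((H H' : Heap m) → SinglyLinked null H → SinglyLinked null H' →
       H ∼ H' → H' ∼ H)
  × ((H H' H'' : Heap m) → SinglyLinked null H → SinglyLinked null H' →
       SinglyLinked null H'' → H ∼ H' → H' ∼ H'' → H ∼ H'')
  × ((H H' : Heap m) → SinglyLinked null H → SinglyLinked null H' → H ∼ H' →
         ((x y : Fin m) (r : ℕ∞) → IsPathLength H x y r ⇔ IsPathLength H' x y r)
       × ((x : Fin m) → Circular H x ⇔ Circular H' x)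
       × ((τ : Transformer m) (H₁ H₁' : Heap m) →
            Step null τ H H₁ → Step null τ H' H₁' → H₁ ∼ H₁'))
theorem2 {m} null =
    (λ H _ → ≈⇒∼ (≅-refl _))
  , (λ H H' _ _ h → ≈⇒∼ (≅-sym (∼⇒≈ h)))
  , (λ H H' H'' _ _ _ h h' → ≈⇒∼ (≅-trans (∼⇒≈ h) (∼⇒≈ h')))
  , λ H H' _ linked' h →
      let I = ∼⇒≈ h in
        (λ x y r → mk⇔ (pathLength-≈ I x y r) (pathLength-≈ (≅-sym I) x y r))
      , (λ x → mk⇔ (circular-≈ I x) (circular-≈ (≅-sym I) x))
      , λ τ H₁ H₁' st st' → ≈⇒∼ (transformer-≈ linked' I τ st st')
  where
  transformer-≈ : ∀ {H H' H₁ H₁'} → SinglyLinked null H' → H ≈ H' →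
                  (τ : Transformer m) → Step null τ H H₁ → Step null τ H' H₁' → H₁ ≈ H₁'
  transformer-≈ _ I (new x) new new = New.new-≈ null x I
  transformer-≈ _ I (assign x y) assign assign = assign-≈ I
  transformer-≈ linked' I (lookup x y) st st' = lookup-≈ null linked' I st st'
  transformer-≈ _ I (update x y) (update _ _) (update _ _) = Update.update-≈ x y I
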